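{- Let $m\in\mathbb{Z}_2$ and $k\in\mathbb{Z}_2^\times$ with $k\ne-1$, put $\ell=\frac{k-1}{2}$, and assume $v_2(\ell)=0$ and $v_2(m)\ge1$. Then: (1) $\gamma^m z_k$ is conjugate in $\Omega$ to $z_k$; (2) for every $n\ge v_2(k+1)$, the number of vertices at level $n$ that do not belong to a stable cycle of $\gamma^m z_k$ is at most $2^{v_2(k+1)}$; that is, $s_n(\gamma^m z_k)\ge 2^n-2^{v_2(k+1)}$.
   Context: $T$ is the rooted binary tree of finite words over $X=\{0,1\}$, $\Omega=\mathrm{Aut}(T)$ acting on the right. Each $\alpha\in\Omega$ is uniquely $(\alpha_0,\alpha_1)\tau$, $\tau\in\{\mathrm{id},\sigma\}$, meaning $(xv)\alpha=(x)\tau\,(v)\alpha_x$. $\alpha^m$ for $m\in\mathbb{Z}_2$ is the $2$-adic limit of integer powers. Standard odometer $\gamma=(\gamma,\mathrm{id})\sigma$; for $k\in\mathbb{Z}_2^\times$ with $\ell=(k-1)/2$, $z_k=(z_k,\gamma^\ell z_k)$ recursively. $v_2$ is the $2$-adic valuation. A vertex $v$ at level $n$ lies in a stable cycle of $\alpha$ of length $k'$ if its $\alpha$-orbit has $k'$ elements and for every $m'>n$ the vertices at level $m'$ above this orbit form one $\alpha$-cycle of length $2^{m'-n}k'$; $s_n(\alpha)$ counts such vertices at level $n$. -}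

module Defs where

open import Data.Bool using (Bool; true; false; _xor_; not; _∧_; _∨_; if_then_else_)
open import Data.Nat using (ℕ; zero; suc; _+_; _*_; _^_; _≤_; _<_)
open import Data.Vec using (Vec; []; _∷_; take)
open import Data.List using (List)
open import Data.Product using (Σ; ∃; _×_)
open import Relation.Binary.PropositionalEquality using (_≡_)
open import Relation.Nullary using (¬_)

-- 2-adic integers: digit sequences, digit i is the coefficient of 2^i.

ℤ₂ : Set
ℤ₂ = ℕ → Bool

_≈₂_ : ℤ₂ → ℤ₂ → Set
x ≈₂ y = ∀ i → x i ≡ y i

carry : ℤ₂ → ℤ₂ → ℕ → Bool
carry x y zero    = false
carry x y (suc i) = (x i ∧ y i) ∨ (carry x y i ∧ (x i xor y i))

_+₂_ : ℤ₂ → ℤ₂ → ℤ₂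
(x +₂ y) i = (x i xor y i) xor carry x y i

one₂ : ℤ₂
one₂ zero    = true
one₂ (suc _) = false

-₂_ : ℤ₂ → ℤ₂
(-₂ x) = (λ i → not (x i)) +₂ one₂

_-₂_ : ℤ₂ → ℤ₂ → ℤ₂
x -₂ y = x +₂ (-₂ y)

-- division by 2 (exact for even arguments)
half : ℤ₂ → ℤ₂
half x i = x (suc i)

Unit₂ : ℤ₂ → Set
Unit₂ k = k 0 ≡ true

ellOf : ℤ₂ → ℤ₂
ellOf k = half (k -₂ one₂)

V2≥ : ℤ₂ → ℕ → Set
V2≥ x j = ∀ i → i < j → x i ≡ false

V2≡ : ℤ₂ → ℕ → Set
V2≡ x j = V2≥ x j × x j ≡ true

trunc : ℤ₂ → ℕ → ℕ
trunc x zero    = 0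
trunc x (suc N) = trunc x N + (if x N then 2 ^ N else 0)

-- Aut(T) for the binary tree, via portraits: α n v = true iff the
-- section of α at vertex v (of level n) swaps the two letters at its root.
-- Every portrait is an automorphism and vice versa.

Aut : Set
Aut = (n : ℕ) → Vec Bool n → Bool

_≈A_ : Aut → Aut → Set
α ≈A β = ∀ n (v : Vec Bool n) → α n v ≡ β n v

section : Aut → Bool → Aut
section α x n v = α (suc n) (x ∷ v)

act : Aut → ∀ {n} → Vec Bool n → Vec Bool n
act α []      = []
act α (x ∷ v) = (x xor α 0 []) ∷ act (section α x) v

-- product with right action: (v)(α · β) = ((v)α)β
_·_ : Aut → Aut → Aut
(α · β) n v = α n v xor β n (act α v)

idA : Aut
idA _ _ = false

powℕ : Aut → ℕ → Aut
powℕ α zero    = idA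
powℕ α (suc N) = powℕ α N · α

-- α^m for m ∈ ℤ₂: the 2-adic limit of α^(m mod 2^N).  The portrait at a
-- level-n vertex is determined by the action on level n+1, on which α has
-- order dividing 2^(n+1); so the limit's label at v is that of α^(m mod 2^(n+1)).
_^₂_ : Aut → ℤ₂ → Aut
(α ^₂ m) n v = powℕ α (trunc m (suc n)) n v

-- odometer γ = (γ, id)σ
γ : Aut
γ zero    []          = true
γ (suc n) (false ∷ v) = γ n v
γ (suc n) (true ∷ v)  = false

-- z_k = (z_k, γ^ℓ z_k), ℓ = (k-1)/2
zk : ℤ₂ → Aut
zk k zero    []          = false
zk k (suc n) (false ∷ v) = zk k n v
zk k (suc n) (true ∷ v)  = g n v xor zk k n (act g v)
  where g = γ ^₂ ellOf k

-- conjugacy in Ω: β⁻¹ α β = α' , i.e. α β = β α'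
Conjugate : Aut → Aut → Set
Conjugate α α' = Σ Aut λ β → (α · β) ≈A (β · α')

CycleLen : Aut → ∀ {n} → Vec Bool n → ℕ → Set
CycleLen α w t = (1 ≤ t) × (act (powℕ α t) w ≡ w)
               × (∀ s → 1 ≤ s → s < t → ¬ (act (powℕ α s) w ≡ w))

InOrbit : Aut → ∀ {n} → Vec Bool n → Vec Bool n → Set
InOrbit α v u = ∃ λ t → act (powℕ α t) v ≡ u

-- v (level n) lies in a stable cycle of length k': its orbit has k'
-- elements and for every level m' = n + suc d, every vertex above the
-- orbit has α-orbit of length 2^(m'-n) k' (equivalently, since there are
-- exactly 2^(m'-n) k' such vertices, they form a single cycle of that length).
StableCycle : Aut → ∀ {n} → Vec Bool n → ℕ → Set
StableCycle α {n} v k' =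
  CycleLen α v k' ×
  (∀ d (w : Vec Bool (n + suc d)) → InOrbit α v (take n w) →
     CycleLen α w (2 ^ suc d * k'))

InStableCycle : Aut → ∀ {n} → Vec Bool n → Set
InStableCycle α v = ∃ λ k' → StableCycle α v k'

-- Read the vertices of level n as residues modulo 2ⁿ through their binary value, the first
-- letter being the lowest digit.  Then γ acts as v ↦ v - 1, γ^m as v ↦ v - m and z_k as
-- v ↦ k⁻¹ v, so α = γ^m z_k acts as v ↦ k⁻¹ (v - m).  As ℓ is odd and m even,
-- D = m / (k - 1) = (m / 2) / ℓ is a 2-adic integer; in the coordinate Y = v + D the map α is
-- multiplication by k⁻¹, and β = γ^(-D), which acts as v ↦ v + D, satisfies α β = β z_k.
--
-- If v₂(Y v) = a, the α-orbit of v at level n is as long as the multiplicative order of k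
-- modulo 2^(n - a).  With j = v₂(k + 1) one has v₂(k - 1) = 1 and v₂(k^(2^(e+1)) - 1) = e + 1 + j,
-- so that order is 2^(n - a - j) whenever n - a > j, and the same holds at every higher level
-- above the orbit: the cycle is stable.  The remaining vertices have Y v ≡ 0 modulo 2^(n - j);
-- there are 2^j of them.

module Submission where

open import Defs
open import Data.Bool using (Bool)
open import Data.Nat using (ℕ; _≤_; _^_)
open import Data.Vec using (Vec)
open import Data.List using (List; length)
open import Data.List.Membership.Propositional using (_∈_)
open import Data.Product using (∃; _×_)
open import Relation.Nullary using (¬_)

open import Data.Bool using (true; false; _xor_; not; _∧_; _∨_)
import Data.Bool.Properties as Bool
open import Data.Nat as ℕ using (zero; suc; _<_; z≤n; s≤s; _∸_; _≤′_; ≤′-refl; ≤′-step)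
import Data.Nat.Properties as ℕ
import Data.Nat.Divisibility as ℕ∣
open import Data.Nat.Tactic.RingSolver using () renaming (solve-∀ to ℕ-solve-∀)
open import Data.Integer as ℤ using (ℤ; +_; _+_; _*_; -_; _-_) renaming (_^_ to _^ℤ_)
import Data.Integer.Properties as ℤ
open import Data.Integer.DivMod using (_%ℕ_; _/ℕ_; n%ℕd<d; a≡a%ℕn+[a/ℕn]*n)
open import Data.Integer.Divisibility.Signed as ℤ∣ using (divides)
open import Data.Integer.Tactic.RingSolver using (solve-∀)
open import Data.Fin using (Fin; toℕ; fromℕ<)
open import Data.Fin.Properties using (toℕ-fromℕ<)
open import Data.List using (tabulate)
open import Data.List.Properties using (length-tabulate)
open import Data.List.Membership.Propositional.Properties using (∈-tabulate⁺)
open import Data.Vec using ([]; _∷_; take)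
import Data.Vec.Properties as Vec
open import Data.Product using (_,_; proj₁)
open import Data.Sum using (_⊎_; inj₁; inj₂)
open import Function.Bundles using (_⇔_; mk⇔; Equivalence)
open import Function.Construct.Composition using (_⇔-∘_)
open import Level using (0ℓ)
open import Relation.Binary.Bundles using (Setoid)
import Relation.Binary.Reasoning.Setoid as SetoidReasoning
open import Relation.Binary.PropositionalEquality
open import Relation.Nullary using (contradiction)

-- Congruences modulo powers of two

two^ : ℕ → ℤ
two^ n = (+ 2) ^ℤ n

infix 4 _≡_[mod2^_]

record _≡_[mod2^_] (a b : ℤ) (n : ℕ) : Set where
  constructor mod2^
  field two^∣difference : two^ n ℤ∣.∣ (a - b)

open _≡_[mod2^_]

by-difference : ∀ {n a b} e → a - b ≡ e → two^ n ℤ∣.∣ e → a ≡ b [mod2^ n ]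
by-difference e eq p = mod2^ (subst (_ ℤ∣.∣_) (sym eq) p)

mod-reflexive : ∀ {n a b} → a ≡ b → a ≡ b [mod2^ n ]
mod-reflexive {n} {a} refl = mod2^ (divides (+ 0) (trans (ℤ.+-inverseʳ a) (sym (ℤ.*-zeroˡ (two^ n)))))

mod-refl : ∀ {n a} → a ≡ a [mod2^ n ]
mod-refl = mod-reflexive refl

mod-sym : ∀ {n a b} → a ≡ b [mod2^ n ] → b ≡ a [mod2^ n ]
mod-sym {a = a} {b} p = by-difference (- (a - b)) (swap a b) (ℤ∣.∣m⇒∣-m (two^∣difference p))
  where
  swap : ∀ a b → b - a ≡ - (a - b)
  swap = solve-∀

mod-trans : ∀ {n a b c} → a ≡ b [mod2^ n ] → b ≡ c [mod2^ n ] → a ≡ c [mod2^ n ]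
mod-trans {a = a} {b} {c} p q = by-difference ((a - b) + (b - c)) (sym (ℤ.+-minus-telescope a b c))
  (ℤ∣.∣m∣n⇒∣m+n (two^∣difference p) (two^∣difference q))

mod-setoid : ℕ → Setoid 0ℓ 0ℓ
mod-setoid n = record
  { Carrier = ℤ
  ; _≈_ = _≡_[mod2^ n ]
  ; isEquivalence = record { refl = mod-refl ; sym = mod-sym ; trans = mod-trans }
  }

module mod-Reasoning (n : ℕ) = SetoidReasoning (mod-setoid n)

+-cong-mod : ∀ {n a b c d} → a ≡ b [mod2^ n ] → c ≡ d [mod2^ n ] → a + c ≡ b + d [mod2^ n ]
+-cong-mod {a = a} {b} {c} {d} p q =
  by-difference ((a - b) + (c - d)) (interchange a b c d)
    (ℤ∣.∣m∣n⇒∣m+n (two^∣difference p) (two^∣difference q))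
  where
  interchange : ∀ a b c d → a + c - (b + d) ≡ (a - b) + (c - d)
  interchange = solve-∀

-‿cong-mod : ∀ {n a b c d} → a ≡ b [mod2^ n ] → c ≡ d [mod2^ n ] → a - c ≡ b - d [mod2^ n ]
-‿cong-mod {a = a} {b} {c} {d} p q =
  by-difference ((a - b) - (c - d)) (interchange a b c d)
    (ℤ∣.∣m∣n⇒∣m-n (two^∣difference p) (two^∣difference q))
  where
  interchange : ∀ a b c d → a - c - (b - d) ≡ (a - b) - (c - d)
  interchange = solve-∀

neg-cong-mod : ∀ {n a b} → a ≡ b [mod2^ n ] → - a ≡ - b [mod2^ n ]
neg-cong-mod {a = a} {b} p = by-difference (- (a - b)) (negate a b) (ℤ∣.∣m⇒∣-m (two^∣difference p))
  where
  negate : ∀ a b → - a - - b ≡ - (a - b)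
  negate = solve-∀

+-cancelˡ-mod : ∀ {n} c {x y} → c + x ≡ c + y [mod2^ n ] → x ≡ y [mod2^ n ]
+-cancelˡ-mod c {x} {y} p = by-difference (c + x - (c + y)) (cancel c x y) (two^∣difference p)
  where
  cancel : ∀ c x y → x - y ≡ c + x - (c + y)
  cancel = solve-∀

+-cancelʳ-mod : ∀ {n} c {x y} → x + c ≡ y + c [mod2^ n ] → x ≡ y [mod2^ n ]
+-cancelʳ-mod c {x} {y} p = by-difference (x + c - (y + c)) (cancel c x y) (two^∣difference p)
  where
  cancel : ∀ c x y → x - y ≡ x + c - (y + c)
  cancel = solve-∀

*-cong-mod : ∀ {n a b c d} → a ≡ b [mod2^ n ] → c ≡ d [mod2^ n ] → a * c ≡ b * d [mod2^ n ]
*-cong-mod {a = a} {b} {c} {d} p q =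
  by-difference ((a - b) * c + b * (c - d)) (split a b c d)
    (ℤ∣.∣m∣n⇒∣m+n (ℤ∣.∣m⇒∣m*n c (two^∣difference p)) (ℤ∣.∣n⇒∣m*n b (two^∣difference q)))
  where
  split : ∀ a b c d → a * c - b * d ≡ (a - b) * c + b * (c - d)
  split = solve-∀

+-congˡ-mod : ∀ {n a b} c → a ≡ b [mod2^ n ] → c + a ≡ c + b [mod2^ n ]
+-congˡ-mod c = +-cong-mod (mod-refl {a = c})

+-congʳ-mod : ∀ {n a b} c → a ≡ b [mod2^ n ] → a + c ≡ b + c [mod2^ n ]
+-congʳ-mod c p = +-cong-mod p (mod-refl {a = c})

-‿congˡ-mod : ∀ {n a b} c → a ≡ b [mod2^ n ] → c - a ≡ c - b [mod2^ n ]
-‿congˡ-mod c = -‿cong-mod (mod-refl {a = c})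

-‿congʳ-mod : ∀ {n a b} c → a ≡ b [mod2^ n ] → a - c ≡ b - c [mod2^ n ]
-‿congʳ-mod c p = -‿cong-mod p (mod-refl {a = c})

*-congˡ-mod : ∀ {n a b} c → a ≡ b [mod2^ n ] → c * a ≡ c * b [mod2^ n ]
*-congˡ-mod c = *-cong-mod (mod-refl {a = c})

*-congʳ-mod : ∀ {n a b} c → a ≡ b [mod2^ n ] → a * c ≡ b * c [mod2^ n ]
*-congʳ-mod c p = *-cong-mod p (mod-refl {a = c})

^-cong-mod : ∀ {n a b} → a ≡ b [mod2^ n ] → ∀ s → a ^ℤ s ≡ b ^ℤ s [mod2^ n ]
^-cong-mod p zero    = mod-refl
^-cong-mod p (suc s) = *-cong-mod p (^-cong-mod p s)

mod-zero : ∀ {a b} → a ≡ b [mod2^ 0 ]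
mod-zero {a} {b} = mod2^ (divides (a - b) (sym (ℤ.*-identityʳ (a - b))))

two^-mono-∣ : ∀ {m n} → m ≤ n → two^ m ℤ∣.∣ two^ n
two^-mono-∣ {m} {n} m≤n = divides (two^ (n ∸ m)) (begin
  two^ n                 ≡⟨ cong two^ (sym (ℕ.m∸n+n≡m m≤n)) ⟩
  two^ (n ∸ m ℕ.+ m)     ≡⟨ ℤ.^-distribˡ-+-* (+ 2) (n ∸ m) m ⟩
  two^ (n ∸ m) * two^ m  ∎)
  where open ≡-Reasoning

mod-weaken : ∀ {m n a b} → m ≤ n → a ≡ b [mod2^ n ] → a ≡ b [mod2^ m ]
mod-weaken m≤n p = mod2^ (ℤ∣.∣-trans (two^-mono-∣ m≤n) (two^∣difference p))

mod-pred : ∀ {n a b} → a ≡ b [mod2^ suc n ] → a ≡ b [mod2^ n ]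
mod-pred = mod-weaken (ℕ.n≤1+n _)

two^-+ : ∀ e n → two^ (e ℕ.+ n) ≡ two^ e * two^ n
two^-+ = ℤ.^-distribˡ-+-* (+ 2)

two^-nonZero : ∀ e → ℤ.NonZero (two^ e)
two^-nonZero zero    = _
two^-nonZero (suc e) = ℤ.i*j≢0 (+ 2) (two^ e) {{_}} {{two^-nonZero e}}

*-distribˡ-minus : ∀ p a b → p * a - p * b ≡ p * (a - b)
*-distribˡ-minus = solve-∀

*two^-mod : ∀ e {n a b} → a ≡ b [mod2^ n ] → two^ e * a ≡ two^ e * b [mod2^ e ℕ.+ n ]
*two^-mod e {n} {a} {b} p = by-difference (two^ e * (a - b)) (*-distribˡ-minus (two^ e) a b)
  (subst (ℤ∣._∣ _) (sym (two^-+ e n)) (ℤ∣.*-monoʳ-∣ (two^ e) (two^∣difference p)))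

*two^-cancel-mod : ∀ e {n a b} → two^ e * a ≡ two^ e * b [mod2^ e ℕ.+ n ] → a ≡ b [mod2^ n ]
*two^-cancel-mod e {n} {a} {b} p = mod2^ (ℤ∣.*-cancelˡ-∣ (two^ e) {{two^-nonZero e}}
  (subst₂ ℤ∣._∣_ (two^-+ e n) (*-distribˡ-minus (two^ e) a b) (two^∣difference p)))

double-mod : ∀ {n a b} → a ≡ b [mod2^ n ] → + 2 * a ≡ + 2 * b [mod2^ suc n ]
double-mod = *two^-mod 1

halve-mod : ∀ {n a b} → + 2 * a ≡ + 2 * b [mod2^ suc n ] → a ≡ b [mod2^ n ]
halve-mod = *two^-cancel-mod 1

pos-two^ : ∀ n → + (2 ^ n) ≡ two^ n
pos-two^ zero    = refl
pos-two^ (suc n) = trans (ℤ.pos-* 2 (2 ^ n)) (cong (+ 2 *_) (pos-two^ n))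

residue : ℕ → ℤ → ℕ
residue n y = _%ℕ_ y (2 ^ n) {{ℕ.m^n≢0 2 n}}

residue-< : ∀ n y → residue n y < 2 ^ n
residue-< n y = n%ℕd<d y (2 ^ n) {{ℕ.m^n≢0 2 n}}

residue-≡ : ∀ n y → + residue n y ≡ y [mod2^ n ]
residue-≡ n y = by-difference (- q * two^ n) (begin
  + residue n y - y                                ≡⟨ cong (_-_ (+ residue n y)) y≡r+q2ⁿ ⟩
  + residue n y - (+ residue n y + q * + (2 ^ n))  ≡⟨ cancel (+ residue n y) q (+ (2 ^ n)) ⟩
  - q * + (2 ^ n)                                  ≡⟨ cong (- q *_) (pos-two^ n) ⟩
  - q * two^ n                                     ∎) (divides (- q) refl)
  where
  open ≡-Reasoning
  q : ℤ
  q = _/ℕ_ y (2 ^ n) {{ℕ.m^n≢0 2 n}}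
  y≡r+q2ⁿ : y ≡ + residue n y + q * + (2 ^ n)
  y≡r+q2ⁿ = a≡a%ℕn+[a/ℕn]*n y (2 ^ n) {{ℕ.m^n≢0 2 n}}
  cancel : ∀ r q p → r - (r + q * p) ≡ - q * p
  cancel = solve-∀

-- Odd numbers and their inverses modulo 2ⁿ

Odd : ℤ → Set
Odd u = u ≡ + 1 [mod2^ 1 ]

odd-* : ∀ {u v} → Odd u → Odd v → Odd (u * v)
odd-* = *-cong-mod

odd-^ : ∀ {u} → Odd u → ∀ s → Odd (u ^ℤ s)
odd-^ p s = mod-trans (^-cong-mod p s) (mod-reflexive (ℤ.^-zeroˡ s))

square-≡1 : ∀ {n x} → x ≡ + 1 [mod2^ suc n ] → x * x ≡ + 1 [mod2^ suc (suc n) ]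
square-≡1 {n} {x} (mod2^ (divides q x-1≡q2ⁿ⁺¹)) = mod2^ (divides (q * q * two^ n + q) (begin
  x * x - + 1                                                             ≡⟨ expand-square x ⟩
  (x - + 1) * (x - + 1) + + 2 * (x - + 1)                                 ≡⟨ cong (λ t → t * t + + 2 * t) x-1≡q2ⁿ⁺¹ ⟩
  q * (+ 2 * two^ n) * (q * (+ 2 * two^ n)) + + 2 * (q * (+ 2 * two^ n))  ≡⟨ regroup q (two^ n) ⟩
  (q * q * two^ n + q) * (+ 2 * (+ 2 * two^ n))                           ∎))
  where
  open ≡-Reasoning
  expand-square : ∀ x → x * x - + 1 ≡ (x - + 1) * (x - + 1) + + 2 * (x - + 1)
  expand-square = solve-∀
  regroup : ∀ q p → q * (+ 2 * p) * (q * (+ 2 * p)) + + 2 * (q * (+ 2 * p)) ≡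
                    (q * q * p + q) * (+ 2 * (+ 2 * p))
  regroup = solve-∀

^-two^-suc : ∀ u n → u ^ℤ (2 ^ suc n) ≡ u ^ℤ (2 ^ n) * u ^ℤ (2 ^ n)
^-two^-suc u n = trans (cong (u ^ℤ_) (cong (2 ^ n ℕ.+_) (ℕ.+-identityʳ (2 ^ n))))
                     (ℤ.^-distribˡ-+-* u (2 ^ n) (2 ^ n))

odd-^-2^ : ∀ {u} → Odd u → ∀ n → u ^ℤ (2 ^ n) ≡ + 1 [mod2^ suc n ]
odd-^-2^ {u} p zero    = mod-trans (mod-reflexive (ℤ.^-identityʳ u)) p
odd-^-2^ {u} p (suc n) = mod-trans (mod-reflexive (^-two^-suc u n)) (square-≡1 (odd-^-2^ p n))

inverse : ℕ → ℤ → ℤ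
inverse n u = u ^ℤ (2 ^ n ∸ 1)

*-inverse : ∀ {u} → Odd u → ∀ n → u * inverse n u ≡ + 1 [mod2^ n ]
*-inverse {u} p n = mod-trans (mod-reflexive (cong (u ^ℤ_) (ℕ.suc-pred (2 ^ n) {{ℕ.m^n≢0 2 n}})))
                              (mod-pred (odd-^-2^ p n))

inverse-cancel : ∀ {u} → Odd u → ∀ n x → inverse n u * (u * x) ≡ x [mod2^ n ]
inverse-cancel {u} p n x = begin
  inverse n u * (u * x)  ≡⟨ reassociate u (inverse n u) x ⟩
  (u * inverse n u) * x  ≈⟨ *-congʳ-mod x (*-inverse p n) ⟩
  + 1 * x                ≡⟨ ℤ.*-identityˡ x ⟩
  x                      ∎
  where
  open mod-Reasoning n
  reassociate : ∀ u w x → w * (u * x) ≡ (u * w) * x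
  reassociate = solve-∀

odd-cancel : ∀ {n u x y} → Odd u → u * x ≡ u * y [mod2^ n ] → x ≡ y [mod2^ n ]
odd-cancel {n} {u} {x} {y} p ux≡uy = begin
  x                      ≈⟨ inverse-cancel p n x ⟨
  inverse n u * (u * x)  ≈⟨ *-congˡ-mod (inverse n u) ux≡uy ⟩
  inverse n u * (u * y)  ≈⟨ inverse-cancel p n y ⟩
  y                      ∎
  where open mod-Reasoning n

-- Binary digits and 2-adic valuations

bit : Bool → ℤ
bit false = + 0
bit true  = + 1

bit-decomposition : ∀ y → ∃ λ b → y ≡ bit b + + 2 * (y /ℕ 2)
bit-decomposition y with y %ℕ 2 | n%ℕd<d y 2 | a≡a%ℕn+[a/ℕn]*n y 2
... | 0 | _ | y≡r+2q = false , trans y≡r+2q (cong (_+_ (bit false)) (ℤ.*-comm (y /ℕ 2) (+ 2)))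
... | 1 | _ | y≡r+2q = true , trans y≡r+2q (cong (_+_ (bit true)) (ℤ.*-comm (y /ℕ 2) (+ 2)))
... | suc (suc _) | s≤s (s≤s ()) | _

1≢0-mod2 : ¬ (+ 1 ≡ + 0 [mod2^ 1 ])
1≢0-mod2 (mod2^ 2∣1) with ℕ∣.∣⇒≤ (ℤ∣.∣⇒∣ᵤ 2∣1)
... | s≤s ()

+2*-mod2 : ∀ x q → x + + 2 * q ≡ x [mod2^ 1 ]
+2*-mod2 x q = mod2^ (divides q (cancel x q))
  where
  cancel : ∀ x q → x + + 2 * q - x ≡ q * + 2
  cancel = solve-∀

bit-injective-mod2 : ∀ {b c} → bit b ≡ bit c [mod2^ 1 ] → b ≡ c
bit-injective-mod2 {false} {false} _ = refl
bit-injective-mod2 {false} {true}  p = contradiction (mod-sym p) 1≢0-mod2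
bit-injective-mod2 {true}  {false} p = contradiction p 1≢0-mod2
bit-injective-mod2 {true}  {true}  _ = refl

record Val₂ (a : ℕ) (y : ℤ) : Set where
  constructor val₂
  field
    oddPart       : ℤ
    oddPart-odd   : Odd oddPart
    factorization : y ≡ two^ a * oddPart

val₂-odd : ∀ {u} → Odd u → Val₂ 0 u
val₂-odd {u} p = val₂ u p (sym (ℤ.*-identityˡ u))

val₂-two^ : ∀ a → Val₂ a (two^ a)
val₂-two^ a = val₂ (+ 1) mod-refl (sym (ℤ.*-identityʳ (two^ a)))

val₂-* : ∀ {a b y z} → Val₂ a y → Val₂ b z → Val₂ (a ℕ.+ b) (y * z)
val₂-* {a} {b} (val₂ o o-odd refl) (val₂ o′ o′-odd refl) = val₂ (o * o′) (odd-* o-odd o′-odd) (begin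
  two^ a * o * (two^ b * o′)  ≡⟨ interchange (two^ a) (two^ b) o o′ ⟩
  two^ a * two^ b * (o * o′)  ≡⟨ cong (_* (o * o′)) (two^-+ a b) ⟨
  two^ (a ℕ.+ b) * (o * o′)   ∎)
  where
  open ≡-Reasoning
  interchange : ∀ p p′ o o′ → p * o * (p′ * o′) ≡ p * p′ * (o * o′)
  interchange = solve-∀

val₂-cong : ∀ {a y y′} → Val₂ a y → y′ ≡ y [mod2^ suc a ] → Val₂ a y′
val₂-cong {a} {y′ = y′} (val₂ o o-odd refl) (mod2^ (divides q y′-y≡q2ᵃ⁺¹)) =
  val₂ (o + + 2 * q) (mod-trans (+2*-mod2 o q) o-odd) (begin
    y′                               ≡⟨ split y′ (two^ a * o) ⟩
    (y′ - two^ a * o) + two^ a * o   ≡⟨ cong (_+ two^ a * o) y′-y≡q2ᵃ⁺¹ ⟩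
    q * (+ 2 * two^ a) + two^ a * o  ≡⟨ regroup q (two^ a) o ⟩
    two^ a * (o + + 2 * q)           ∎)
  where
  open ≡-Reasoning
  split : ∀ y′ y → y′ ≡ (y′ - y) + y
  split = solve-∀
  regroup : ∀ q p o → q * (+ 2 * p) + p * o ≡ p * (o + + 2 * q)
  regroup = solve-∀

val₂⇒≡0 : ∀ {a y} → Val₂ a y → y ≡ + 0 [mod2^ a ]
val₂⇒≡0 {a} (val₂ o _ refl) = mod2^ (divides o (trans (ℤ.+-identityʳ _) (ℤ.*-comm (two^ a) o)))

≡0⇒≡ : ∀ {n a b} → a - b ≡ + 0 [mod2^ n ] → a ≡ b [mod2^ n ]
≡0⇒≡ {a = a} {b} p = mod2^ (subst (_ ℤ∣.∣_) (ℤ.+-identityʳ (a - b)) (two^∣difference p))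

module _ {a y} (y-val₂ : Val₂ a y) where
  open Val₂ y-val₂

  private
    pull-two^ : ∀ x → x * y ≡ two^ a * (oddPart * x)
    pull-two^ x = trans (cong (x *_) factorization) (commute x (two^ a) oddPart)
      where
      commute : ∀ x p o → x * (p * o) ≡ p * (o * x)
      commute = solve-∀

  val₂-*-cancel : ∀ {r x x′} → x * y ≡ x′ * y [mod2^ r ℕ.+ a ] → x ≡ x′ [mod2^ r ]
  val₂-*-cancel {r} {x} {x′} p = odd-cancel oddPart-odd (*two^-cancel-mod a
    (subst₂ (_≡_[mod2^ a ℕ.+ r ]) (pull-two^ x) (pull-two^ x′)
            (subst (x * y ≡ x′ * y [mod2^_]) (ℕ.+-comm r a) p)))

  val₂-*-cong : ∀ {r x x′} → x ≡ x′ [mod2^ r ] → x * y ≡ x′ * y [mod2^ r ℕ.+ a ]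
  val₂-*-cong {r} {x} {x′} p = subst (x * y ≡ x′ * y [mod2^_]) (ℕ.+-comm a r)
    (subst₂ (_≡_[mod2^ a ℕ.+ r ]) (sym (pull-two^ x)) (sym (pull-two^ x′))
            (*two^-mod a (*-congˡ-mod oddPart p)))

val₂-+1 : ∀ {a X} → 2 ≤ a → Val₂ a (X - + 1) → Val₂ 1 (X + + 1)
val₂-+1 {X = X} 2≤a p = val₂-cong (val₂-two^ 1)
  (by-difference (X - + 1 - + 0) (shift X) (two^∣difference (mod-weaken 2≤a (val₂⇒≡0 p))))
  where
  shift : ∀ X → X + + 1 - + 2 ≡ X - + 1 - + 0
  shift = solve-∀

val₂-cancel-odd : ∀ {a u y} → Odd u → Val₂ a (u * y) → Val₂ a y
val₂-cancel-odd {a} {u} {y} u-odd uy-val₂ =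
  val₂-cong (val₂-* (val₂-odd (odd-^ u-odd (2 ^ suc a ∸ 1))) uy-val₂)
            (mod-sym (inverse-cancel u-odd (suc a) y))

val₂-or-divisible : ∀ e y → y ≡ + 0 [mod2^ e ] ⊎ ∃ λ a → a < e × Val₂ a y
val₂-or-divisible zero    y = inj₁ mod-zero
val₂-or-divisible (suc e) y with bit-decomposition y
... | true  , y≡1+2h =
  inj₂ (0 , s≤s z≤n , val₂-odd (mod-trans (mod-reflexive y≡1+2h) (+2*-mod2 (+ 1) (y /ℕ 2))))
... | false , y≡0+2h with trans y≡0+2h (ℤ.+-identityˡ _) | val₂-or-divisible e (y /ℕ 2)
...   | y≡2h | inj₁ h≡0                 = inj₁ (mod-trans (mod-reflexive y≡2h) (double-mod h≡0))
...   | y≡2h | inj₂ (a , a<e , h-val₂) =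
  inj₂ (suc a , s≤s a<e , subst (Val₂ (suc a)) (sym y≡2h) (val₂-* (val₂-two^ 1) h-val₂))

-- The multiplicative order of k modulo powers of two

pow-near-one : ∀ {r X} → X ≡ + 1 [mod2^ suc r ] → ∀ q →
               X ^ℤ q ≡ + 1 + + q * (X - + 1) [mod2^ suc (suc r) ]
pow-near-one {X = X} _ zero = mod-reflexive (no-term X)
  where
  no-term : ∀ X → + 1 ≡ + 1 + + 0 * (X - + 1)
  no-term = solve-∀
pow-near-one {r} {X} X≡1@(mod2^ (divides c X-1≡c2ʳ⁺¹)) (suc q) = begin
  X * X ^ℤ q                                                   ≈⟨ *-congˡ-mod X (pow-near-one X≡1 q) ⟩
  X * (+ 1 + + q * (X - + 1))                                  ≡⟨ expand X (+ q) ⟩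
  + 1 + (+ 1 + + q) * (X - + 1) + + q * (X - + 1) * (X - + 1)  ≈⟨ +-congˡ-mod (+ 1 + + suc q * (X - + 1)) square-vanishes ⟩
  + 1 + + suc q * (X - + 1) + + 0                              ≡⟨ ℤ.+-identityʳ (+ 1 + + suc q * (X - + 1)) ⟩
  + 1 + + suc q * (X - + 1)                                    ∎
  where
  open mod-Reasoning (suc (suc r))
  expand : ∀ X q → X * (+ 1 + q * (X - + 1)) ≡ + 1 + (+ 1 + q) * (X - + 1) + q * (X - + 1) * (X - + 1)
  expand = solve-∀
  regroup : ∀ q c p → q * (c * (+ 2 * p)) * (c * (+ 2 * p)) - + 0 ≡ (q * c * c * p) * (+ 2 * (+ 2 * p))
  regroup = solve-∀
  -- (X - 1)² is divisible by 2^(2r+2), and 2r + 2 ≥ r + 2.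
  square-vanishes : + q * (X - + 1) * (X - + 1) ≡ + 0 [mod2^ suc (suc r) ]
  square-vanishes = mod2^ (divides (+ q * c * c * two^ r)
    (trans (cong (λ t → + q * t * t - + 0) X-1≡c2ʳ⁺¹) (regroup (+ q) c (two^ r))))

even-exponent : ∀ {r X q} → Val₂ (suc r) (X - + 1) → X ^ℤ q ≡ + 1 [mod2^ suc (suc r) ] → 2 ℕ∣.∣ q
even-exponent {r} {X} {q} X-1-val₂ Xᵠ≡1 = even (val₂-*-cancel X-1-val₂ (begin
  + q * (X - + 1)              ≡⟨ add-subtract (+ q * (X - + 1)) ⟩
  + 1 + + q * (X - + 1) - + 1  ≈⟨ -‿congʳ-mod (+ 1) (pow-near-one X≡1 q) ⟨
  X ^ℤ q - + 1                 ≈⟨ -‿congʳ-mod (+ 1) Xᵠ≡1 ⟩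
  + 1 - + 1                    ≡⟨ ℤ.*-zeroˡ (X - + 1) ⟨
  + 0 * (X - + 1)              ∎))
  where
  open mod-Reasoning (suc (suc r))
  add-subtract : ∀ t → t ≡ + 1 + t - + 1
  add-subtract = solve-∀
  X≡1 : X ≡ + 1 [mod2^ suc r ]
  X≡1 = ≡0⇒≡ (val₂⇒≡0 X-1-val₂)
  even : + q ≡ + 0 [mod2^ 1 ] → 2 ℕ∣.∣ q
  even (mod2^ 2∣q) = subst (2 ℕ∣.∣_) (ℕ.+-identityʳ q) (ℤ∣.∣⇒∣ᵤ 2∣q)

module MultiplicativeOrder {K : ℤ} {j : ℕ} (1≤j : 1 ≤ j)
                           (K-1-val₂ : Val₂ 1 (K - + 1)) (K+1-val₂ : Val₂ j (K + + 1)) where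

  val₂-K^2^-1 : ∀ e → Val₂ (suc e ℕ.+ j) (K ^ℤ (2 ^ suc e) - + 1)
  val₂-K^2^-1 zero    = subst (Val₂ (suc j)) (difference-of-squares K) (val₂-* K-1-val₂ K+1-val₂)
    where
    difference-of-squares : ∀ K → (K - + 1) * (K + + 1) ≡ K * (K * + 1) - + 1
    difference-of-squares = solve-∀
  val₂-K^2^-1 (suc e) = subst (Val₂ (suc (suc e) ℕ.+ j)) X²-1
    (val₂-* (val₂-+1 {X = X} (s≤s (ℕ.≤-trans 1≤j (ℕ.m≤n+m j e))) X-1-val₂) X-1-val₂)
    where
    X : ℤ
    X = K ^ℤ (2 ^ suc e)
    X-1-val₂ : Val₂ (suc e ℕ.+ j) (X - + 1)
    X-1-val₂ = val₂-K^2^-1 e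
    difference-of-squares : ∀ X → (X + + 1) * (X - + 1) ≡ X * X - + 1
    difference-of-squares = solve-∀
    X²-1 : (X + + 1) * (X - + 1) ≡ K ^ℤ (2 ^ suc (suc e)) - + 1
    X²-1 = trans (difference-of-squares X) (cong (_- + 1) (sym (^-two^-suc K (suc e))))

  ^-* : ∀ e q → K ^ℤ (q ℕ.* 2 ^ e) ≡ (K ^ℤ (2 ^ e)) ^ℤ q
  ^-* e q = trans (cong (K ^ℤ_) (ℕ.*-comm q (2 ^ e))) (sym (ℤ.^-*-assoc K (2 ^ e) q))

  divides⇒≡1 : ∀ e s → 2 ^ suc e ℕ∣.∣ s → K ^ℤ s ≡ + 1 [mod2^ suc e ℕ.+ j ]
  divides⇒≡1 e s (ℕ∣.divides q refl) = begin
    K ^ℤ (q ℕ.* 2 ^ suc e)   ≡⟨ ^-* (suc e) q ⟩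
    (K ^ℤ (2 ^ suc e)) ^ℤ q  ≈⟨ ^-cong-mod (≡0⇒≡ (val₂⇒≡0 (val₂-K^2^-1 e))) q ⟩
    (+ 1) ^ℤ q               ≡⟨ ℤ.^-zeroˡ q ⟩
    + 1                      ∎
    where open mod-Reasoning (suc e ℕ.+ j)

  ≡1⇒divides : ∀ e s → K ^ℤ s ≡ + 1 [mod2^ suc e ℕ.+ j ] → 2 ^ suc e ℕ∣.∣ s
  ≡1⇒divides zero    s Kˢ≡1 = even-exponent K-1-val₂ (mod-weaken (s≤s 1≤j) Kˢ≡1)
  ≡1⇒divides (suc e) s Kˢ≡1 with ≡1⇒divides e s (mod-pred Kˢ≡1)
  ... | ℕ∣.divides q refl = ℕ∣.*-monoˡ-∣ (2 ^ suc e) (even-exponent {X = K ^ℤ (2 ^ suc e)} {q}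
                              (val₂-K^2^-1 e) (mod-trans (mod-reflexive (sym (^-* (suc e) q))) Kˢ≡1))

  order : ∀ e s → (K ^ℤ s ≡ + 1 [mod2^ suc e ℕ.+ j ]) ⇔ (2 ^ suc e ℕ∣.∣ s)
  order e s = mk⇔ (≡1⇒divides e s) (divides⇒≡1 e s)

-- Vertices of level n as residues modulo 2ⁿ

val : ∀ {n} → Vec Bool n → ℤ
val []      = + 0
val (b ∷ v) = bit b + + 2 * val v

val-injective : ∀ {n} (v w : Vec Bool n) → val v ≡ val w [mod2^ n ] → v ≡ w
val-injective []      []      _ = refl
val-injective (b ∷ v) (c ∷ w) p with bit-injective-mod2 (begin
    bit b                ≈⟨ +2*-mod2 (bit b) (val v) ⟨
    bit b + + 2 * val v  ≈⟨ mod-weaken (s≤s z≤n) p ⟩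
    bit c + + 2 * val w  ≈⟨ +2*-mod2 (bit c) (val w) ⟩
    bit c                ∎)
  where open mod-Reasoning 1
... | refl = cong (b ∷_) (val-injective v w (halve-mod (+-cancelˡ-mod (bit b) p)))

digits : ∀ n → ℤ → Vec Bool n
digits zero    y = []
digits (suc n) y = proj₁ (bit-decomposition y) ∷ digits n (y /ℕ 2)

val-digits : ∀ n y → val (digits n y) ≡ y [mod2^ n ]
val-digits zero    y = mod-zero
val-digits (suc n) y with bit-decomposition y
... | b , y≡b+2h = mod-trans (+-congˡ-mod (bit b) (double-mod (val-digits n (y /ℕ 2))))
                             (mod-reflexive (sym y≡b+2h))

val-take : ∀ n {m} (w : Vec Bool (n ℕ.+ m)) → val w ≡ val (take n w) [mod2^ n ]
val-take zero    w       = mod-zero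
val-take (suc n) (b ∷ w) = +-congˡ-mod (bit b) (double-mod (val-take n w))

-- Truncations of 2-adic integers

Coherent : (ℕ → ℤ) → Set
Coherent c = ∀ {i n} → i ≤ n → c n ≡ c i [mod2^ i ]

⟦_⟧ : ℤ₂ → ℕ → ℤ
⟦ x ⟧ n = + trunc x n

⟦⟧-suc : ∀ x n → ⟦ x ⟧ (suc n) ≡ ⟦ x ⟧ n + bit (x n) * two^ n
⟦⟧-suc x n with x n
... | true  = cong (_+_ (⟦ x ⟧ n)) (trans (pos-two^ n) (sym (ℤ.*-identityˡ (two^ n))))
... | false = cong (_+_ (⟦ x ⟧ n)) (sym (ℤ.*-zeroˡ (two^ n)))

⟦⟧-coherent : ∀ x → Coherent ⟦ x ⟧
⟦⟧-coherent x i≤n = go (ℕ.≤⇒≤′ i≤n)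
  where
  step : ∀ n → ⟦ x ⟧ (suc n) ≡ ⟦ x ⟧ n [mod2^ n ]
  step n = by-difference (bit (x n) * two^ n) (trans (cong (_- ⟦ x ⟧ n) (⟦⟧-suc x n)) (cancel (⟦ x ⟧ n) _))
                         (divides (bit (x n)) refl)
    where
    cancel : ∀ a b → a + b - a ≡ b
    cancel = solve-∀
  go : ∀ {i n} → i ≤′ n → ⟦ x ⟧ n ≡ ⟦ x ⟧ i [mod2^ i ]
  go ≤′-refl        = mod-refl
  go (≤′-step i≤′n) = mod-trans (mod-weaken (ℕ.≤′⇒≤ i≤′n) (step _)) (go i≤′n)

≡⟦⟧-pred : ∀ {x n K} → K ≡ ⟦ x ⟧ (suc n) [mod2^ suc n ] → K ≡ ⟦ x ⟧ n [mod2^ n ]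
≡⟦⟧-pred {x} {n} K≡x = mod-trans (mod-pred K≡x) (⟦⟧-coherent x (ℕ.n≤1+n n))

⟦⟧-half : ∀ x n → ⟦ x ⟧ (suc n) ≡ bit (x 0) + + 2 * ⟦ half x ⟧ n
⟦⟧-half x zero    = trans (⟦⟧-suc x 0) (no-higher-digits (bit (x 0)))
  where
  no-higher-digits : ∀ b → + 0 + b * + 1 ≡ b + + 2 * + 0
  no-higher-digits = solve-∀
⟦⟧-half x (suc n) = begin
  ⟦ x ⟧ (suc (suc n))                                                ≡⟨ ⟦⟧-suc x (suc n) ⟩
  ⟦ x ⟧ (suc n) + bit (x (suc n)) * two^ (suc n)                     ≡⟨ cong (_+ bit (x (suc n)) * two^ (suc n)) (⟦⟧-half x n) ⟩
  bit (x 0) + + 2 * ⟦ half x ⟧ n + bit (x (suc n)) * (+ 2 * two^ n)  ≡⟨ regroup (bit (x 0)) (⟦ half x ⟧ n) (bit (x (suc n))) (two^ n) ⟩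
  bit (x 0) + + 2 * (⟦ half x ⟧ n + bit (x (suc n)) * two^ n)        ≡⟨ cong (λ t → bit (x 0) + + 2 * t) (⟦⟧-suc (half x) n) ⟨
  bit (x 0) + + 2 * ⟦ half x ⟧ (suc n)                               ∎
  where
  open ≡-Reasoning
  regroup : ∀ a t b p → a + + 2 * t + b * (+ 2 * p) ≡ a + + 2 * (t + b * p)
  regroup = solve-∀

⟦⟧-zeros : ∀ {x n} → V2≥ x n → ⟦ x ⟧ n ≡ + 0
⟦⟧-zeros {n = zero}  _      = refl
⟦⟧-zeros {x} {suc n} zeros = begin
  ⟦ x ⟧ (suc n)                 ≡⟨ ⟦⟧-suc x n ⟩
  ⟦ x ⟧ n + bit (x n) * two^ n  ≡⟨ cong₂ (λ t b → t + bit b * two^ n) (⟦⟧-zeros lower-zeros) (zeros n ℕ.≤-refl) ⟩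
  + 0 + + 0 * two^ n            ≡⟨ trans (ℤ.+-identityˡ _) (ℤ.*-zeroˡ (two^ n)) ⟩
  + 0                           ∎
  where
  open ≡-Reasoning
  lower-zeros : V2≥ x n
  lower-zeros i i<n = zeros i (ℕ.m≤n⇒m≤1+n i<n)

⟦⟧-odd : ∀ {x} → x 0 ≡ true → ∀ n → Odd (⟦ x ⟧ (suc n))
⟦⟧-odd {x} x₀≡1 n = mod-trans
  (mod-reflexive (trans (⟦⟧-half x n) (cong (λ b → bit b + + 2 * ⟦ half x ⟧ n) x₀≡1)))
  (+2*-mod2 (+ 1) (⟦ half x ⟧ n))

⟦one₂⟧ : ∀ n → ⟦ one₂ ⟧ (suc n) ≡ + 1
⟦one₂⟧ n = trans (⟦⟧-half one₂ n) (cong (λ t → + 1 + + 2 * t) (⟦⟧-zeros {half one₂} {n} (λ _ _ → refl)))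

⟦⟧-V2≡ : ∀ {x j} → V2≡ x j → ⟦ x ⟧ (suc j) ≡ two^ j
⟦⟧-V2≡ {x} {j} (zeros , xⱼ≡1) = begin
  ⟦ x ⟧ (suc j)                 ≡⟨ ⟦⟧-suc x j ⟩
  ⟦ x ⟧ j + bit (x j) * two^ j  ≡⟨ cong₂ (λ t b → t + bit b * two^ j) (⟦⟧-zeros zeros) xⱼ≡1 ⟩
  + 0 + + 1 * two^ j            ≡⟨ trans (ℤ.+-identityˡ _) (ℤ.*-identityˡ (two^ j)) ⟩
  two^ j                        ∎
  where open ≡-Reasoning

unit+1-valuation-positive : ∀ {k j} → Unit₂ k → V2≡ (k +₂ one₂) j → 1 ≤ j
unit+1-valuation-positive {j = zero}  k₀≡1 (_ , k+1₀≡1) =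
  contradiction (trans (sym k+1₀≡1) (cong (λ b → (b xor true) xor false) k₀≡1)) λ ()
unit+1-valuation-positive {j = suc _} _    _            = s≤s z≤n

full-adder : ∀ a b c → bit a + bit b + bit c ≡ bit ((a xor b) xor c) + + 2 * bit ((a ∧ b) ∨ (c ∧ (a xor b)))
full-adder false false false = refl
full-adder false false true  = refl
full-adder false true  false = refl
full-adder false true  true  = refl
full-adder true  false false = refl
full-adder true  false true  = refl
full-adder true  true  false = refl
full-adder true  true  true  = refl

⟦⟧-+₂-carry : ∀ x y n → ⟦ x ⟧ n + ⟦ y ⟧ n ≡ ⟦ x +₂ y ⟧ n + bit (carry x y n) * two^ n
⟦⟧-+₂-carry x y zero    = refl
⟦⟧-+₂-carry x y (suc n) = begin
  ⟦ x ⟧ (suc n) + ⟦ y ⟧ (suc n)                    ≡⟨ cong₂ _+_ (⟦⟧-suc x n) (⟦⟧-suc y n) ⟩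
  ⟦ x ⟧ n + bx * two^ n + (⟦ y ⟧ n + by * two^ n)  ≡⟨ regroup₁ (⟦ x ⟧ n) (⟦ y ⟧ n) bx by (two^ n) ⟩
  (⟦ x ⟧ n + ⟦ y ⟧ n) + (bx + by) * two^ n         ≡⟨ cong (_+ (bx + by) * two^ n) (⟦⟧-+₂-carry x y n) ⟩
  s + bc * two^ n + (bx + by) * two^ n             ≡⟨ regroup₂ s bx by bc (two^ n) ⟩
  s + (bx + by + bc) * two^ n                      ≡⟨ cong (λ t → s + t * two^ n) (full-adder (x n) (y n) (carry x y n)) ⟩
  s + (bs + + 2 * bc′) * two^ n                    ≡⟨ regroup₃ s bs bc′ (two^ n) ⟩
  s + bs * two^ n + bc′ * (+ 2 * two^ n)           ≡⟨ cong (_+ bc′ * (+ 2 * two^ n)) (⟦⟧-suc (x +₂ y) n) ⟨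
  ⟦ x +₂ y ⟧ (suc n) + bc′ * two^ (suc n)          ∎
  where
  open ≡-Reasoning
  s bx by bc bs bc′ : ℤ
  s   = ⟦ x +₂ y ⟧ n
  bx  = bit (x n)
  by  = bit (y n)
  bc  = bit (carry x y n)
  bs  = bit ((x n xor y n) xor carry x y n)
  bc′ = bit (carry x y (suc n))
  regroup₁ : ∀ a b p q r → a + p * r + (b + q * r) ≡ (a + b) + (p + q) * r
  regroup₁ = solve-∀
  regroup₂ : ∀ a p q c r → a + c * r + (p + q) * r ≡ a + (p + q + c) * r
  regroup₂ = solve-∀
  regroup₃ : ∀ a s c r → a + (s + + 2 * c) * r ≡ a + s * r + c * (+ 2 * r)
  regroup₃ = solve-∀

⟦⟧-+₂ : ∀ x y n → ⟦ x +₂ y ⟧ n ≡ ⟦ x ⟧ n + ⟦ y ⟧ n [mod2^ n ]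
⟦⟧-+₂ x y n = by-difference (- c * two^ n)
  (trans (cong (_-_ (⟦ x +₂ y ⟧ n)) (⟦⟧-+₂-carry x y n)) (cancel (⟦ x +₂ y ⟧ n) c (two^ n)))
  (divides (- c) refl)
  where
  c : ℤ
  c = bit (carry x y n)
  cancel : ∀ s c p → s - (s + c * p) ≡ - c * p
  cancel = solve-∀

⟦⟧-all-ones : ∀ {x} → (∀ i → x i ≡ true) → ∀ n → ⟦ x ⟧ n + + 1 ≡ two^ n
⟦⟧-all-ones     ones zero    = refl
⟦⟧-all-ones {x} ones (suc n) = begin
  ⟦ x ⟧ (suc n) + + 1                 ≡⟨ cong (_+ + 1) (⟦⟧-suc x n) ⟩
  ⟦ x ⟧ n + bit (x n) * two^ n + + 1  ≡⟨ cong (λ b → ⟦ x ⟧ n + bit b * two^ n + + 1) (ones n) ⟩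
  ⟦ x ⟧ n + + 1 * two^ n + + 1        ≡⟨ regroup (⟦ x ⟧ n) (two^ n) ⟩
  ⟦ x ⟧ n + + 1 + two^ n              ≡⟨ cong (_+ two^ n) (⟦⟧-all-ones ones n) ⟩
  two^ n + two^ n                     ≡⟨ double (two^ n) ⟩
  + 2 * two^ n                        ∎
  where
  open ≡-Reasoning
  regroup : ∀ t p → t + + 1 * p + + 1 ≡ t + + 1 + p
  regroup = solve-∀
  double : ∀ p → p + p ≡ + 2 * p
  double = solve-∀

minus-one-digits : ∀ i → (-₂ one₂) i ≡ true
minus-one-digits zero    = refl
minus-one-digits (suc i) = cong not (no-carry (suc i))
  where
  no-carry : ∀ i → carry (λ i → not (one₂ i)) one₂ i ≡ false
  no-carry zero          = refl
  no-carry (suc zero)    = refl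
  no-carry (suc (suc i)) = cong (_∧ true) (no-carry (suc i))

⟦-1⟧ : ∀ n → ⟦ -₂ one₂ ⟧ n ≡ - + 1 [mod2^ n ]
⟦-1⟧ n = by-difference (⟦ -₂ one₂ ⟧ n + + 1) refl
  (divides (+ 1) (trans (⟦⟧-all-ones minus-one-digits n) (sym (ℤ.*-identityˡ (two^ n)))))

⟦ellOf⟧ : ∀ {k} → Unit₂ k → ∀ n → ⟦ k ⟧ (suc n) - + 1 ≡ + 2 * ⟦ ellOf k ⟧ n [mod2^ suc n ]
⟦ellOf⟧ {k} k₀≡1 n = begin
  ⟦ k ⟧ (suc n) - + 1                        ≈⟨ +-congˡ-mod (⟦ k ⟧ (suc n)) (⟦-1⟧ (suc n)) ⟨
  ⟦ k ⟧ (suc n) + ⟦ -₂ one₂ ⟧ (suc n)        ≈⟨ ⟦⟧-+₂ k (-₂ one₂) (suc n) ⟨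
  ⟦ k -₂ one₂ ⟧ (suc n)                      ≡⟨ ⟦⟧-half (k -₂ one₂) n ⟩
  bit ((k -₂ one₂) 0) + + 2 * ⟦ ellOf k ⟧ n  ≡⟨ cong (λ b → bit ((b xor true) xor false) + + 2 * ⟦ ellOf k ⟧ n) k₀≡1 ⟩
  + 0 + + 2 * ⟦ ellOf k ⟧ n                  ≡⟨ ℤ.+-identityˡ _ ⟩
  + 2 * ⟦ ellOf k ⟧ n                        ∎
  where open mod-Reasoning (suc n)

-- Automorphisms acting on a level

act-idA : ∀ {n} (v : Vec Bool n) → act idA v ≡ v
act-idA []      = refl
act-idA (x ∷ v) = cong₂ _∷_ (Bool.xor-identityʳ x) (act-idA v)

act-· : ∀ α β {n} (v : Vec Bool n) → act (α · β) v ≡ act β (act α v)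
act-· α β []      = refl
act-· α β (x ∷ v) = cong₂ _∷_ (sym (Bool.xor-assoc x (α 0 []) (β 0 [])))
                              (act-· (section α x) (section β (x xor α 0 [])) v)

act-agree : ∀ α β {n} → (∀ i → i < n → ∀ w → α i w ≡ β i w) →
            (v : Vec Bool n) → act α v ≡ act β v
act-agree α β agree []      = refl
act-agree α β agree (x ∷ v) = cong₂ _∷_ (cong (x xor_) (agree 0 (s≤s z≤n) []))
  (act-agree (section α x) (section β x) (λ i i<n w → agree (suc i) (s≤s i<n) (x ∷ w)) v)

portrait-from-action : ∀ α β i → (∀ (u : Vec Bool (suc i)) → act α u ≡ act β u) → ∀ w → α i w ≡ β i w
portrait-from-action α β zero    same []      = Vec.∷-injectiveˡ (same (false ∷ []))
portrait-from-action α β (suc i) same (x ∷ w) =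
  portrait-from-action (section α x) (section β x) i (λ u → Vec.∷-injectiveʳ (same (x ∷ u))) w

≈A-from-action : ∀ α β → (∀ {n} (u : Vec Bool n) → act α u ≡ act β u) → α ≈A β
≈A-from-action α β same i = portrait-from-action α β i same

act-γ : ∀ {n} (v : Vec Bool n) → val (act γ v) ≡ val v - + 1 [mod2^ n ]
act-γ []          = mod-zero
act-γ {suc n} (false ∷ v) = begin
  + 1 + + 2 * val (act γ v)  ≈⟨ +-congˡ-mod (+ 1) (double-mod (act-γ v)) ⟩
  + 1 + + 2 * (val v - + 1)  ≡⟨ borrow (val v) ⟩
  + 0 + + 2 * val v - + 1    ∎
  where
  open mod-Reasoning (suc n)
  borrow : ∀ a → + 1 + + 2 * (a - + 1) ≡ + 0 + + 2 * a - + 1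
  borrow = solve-∀
act-γ (true ∷ v) = mod-reflexive (trans (cong (λ u → + 0 + + 2 * val u) (act-idA v)) (no-borrow (val v)))
  where
  no-borrow : ∀ a → + 0 + + 2 * a ≡ + 1 + + 2 * a - + 1
  no-borrow = solve-∀

act-γ^ : ∀ s {n} (v : Vec Bool n) → val (act (powℕ γ s) v) ≡ val v - + s [mod2^ n ]
act-γ^ zero    v = mod-reflexive (trans (cong val (act-idA v)) (sym (ℤ.+-identityʳ (val v))))
act-γ^ (suc s) {n} v = begin
  val (act (powℕ γ s · γ) v)      ≡⟨ cong val (act-· (powℕ γ s) γ v) ⟩
  val (act γ (act (powℕ γ s) v))  ≈⟨ act-γ (act (powℕ γ s) v) ⟩
  val (act (powℕ γ s) v) - + 1    ≈⟨ -‿congʳ-mod (+ 1) (act-γ^ s v) ⟩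
  val v - + s - + 1               ≡⟨ subtract (val v) (+ s) ⟩
  val v - (+ 1 + + s)             ∎
  where
  open mod-Reasoning n
  subtract : ∀ a s → a - s - + 1 ≡ a - (+ 1 + s)
  subtract = solve-∀

powℕ-γ-agree : ∀ {s t i} → + s ≡ + t [mod2^ suc i ] → ∀ w → powℕ γ s i w ≡ powℕ γ t i w
powℕ-γ-agree {s} {t} {i} s≡t = portrait-from-action (powℕ γ s) (powℕ γ t) i λ u →
  val-injective _ _ (mod-trans (act-γ^ s u) (mod-trans (-‿congˡ-mod (val u) s≡t) (mod-sym (act-γ^ t u))))

-- The 2-adic power of γ along a sequence of exponents; γ ^₂ m is γ^⟨ trunc m ⟩.
γ^⟨_⟩ : (ℕ → ℕ) → Aut
γ^⟨ f ⟩ i w = powℕ γ (f (suc i)) i w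

act-γ^⟨⟩ : ∀ {f} → Coherent (λ n → + f n) → ∀ {n} (v : Vec Bool n) →
           val (act γ^⟨ f ⟩ v) ≡ val v - + f n [mod2^ n ]
act-γ^⟨⟩ {f} coherent {n} v =
  mod-trans (mod-reflexive (cong val (act-agree γ^⟨ f ⟩ (powℕ γ (f n)) agree v))) (act-γ^ (f n) v)
  where
  agree : ∀ i → i < n → ∀ w → powℕ γ (f (suc i)) i w ≡ powℕ γ (f n) i w
  agree i i<n = powℕ-γ-agree (mod-sym (coherent i<n))

act-γ^₂ : ∀ m {n} (v : Vec Bool n) → val (act (γ ^₂ m) v) ≡ val v - ⟦ m ⟧ n [mod2^ n ]
act-γ^₂ m = act-γ^⟨⟩ (⟦⟧-coherent m)

act-zk : ∀ {k} → Unit₂ k → ∀ {n K} → K ≡ ⟦ k ⟧ n [mod2^ n ] → (v : Vec Bool n) →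
         K * val (act (zk k) v) ≡ val v [mod2^ n ]
act-zk k₀≡1 _ [] = mod-zero
act-zk {k} k₀≡1 {suc n} {K} K≡k (false ∷ v) = begin
  K * (+ 0 + + 2 * val (act (zk k) v))  ≡⟨ shift K (val (act (zk k) v)) ⟩
  + 0 + + 2 * (K * val (act (zk k) v))  ≈⟨ +-congˡ-mod (+ 0) (double-mod (act-zk k₀≡1 (≡⟦⟧-pred K≡k) v)) ⟩
  + 0 + + 2 * val v                     ∎
  where
  open mod-Reasoning (suc n)
  shift : ∀ K z → K * (+ 0 + + 2 * z) ≡ + 0 + + 2 * (K * z)
  shift = solve-∀
act-zk {k} k₀≡1 {suc n} {K} K≡k (true ∷ v) = begin
  K * (+ 1 + + 2 * val (act (g · zk k) v))  ≡⟨ cong (λ u → K * (+ 1 + + 2 * val u)) (act-· g (zk k) v) ⟩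
  K * (+ 1 + + 2 * Z)                       ≡⟨ expand K Z ⟩
  K + + 2 * (K * Z)                         ≈⟨ +-cong-mod K≡2ℓ+1 (double-mod KZ≡v-ℓ) ⟩
  + 1 + + 2 * ℓ + + 2 * (val v - ℓ)         ≡⟨ cancel ℓ (val v) ⟩
  + 1 + + 2 * val v                         ∎
  where
  open mod-Reasoning (suc n)
  g : Aut
  g = γ ^₂ ellOf k
  Z ℓ : ℤ
  Z = val (act (zk k) (act g v))
  ℓ = ⟦ ellOf k ⟧ n
  expand : ∀ K Z → K * (+ 1 + + 2 * Z) ≡ K + + 2 * (K * Z)
  expand = solve-∀
  cancel : ∀ ℓ a → + 1 + + 2 * ℓ + + 2 * (a - ℓ) ≡ + 1 + + 2 * a
  cancel = solve-∀
  shift : ∀ a → a ≡ + 1 + (a - + 1)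
  shift = solve-∀
  K≡2ℓ+1 : K ≡ + 1 + + 2 * ℓ [mod2^ suc n ]
  K≡2ℓ+1 = mod-trans K≡k (mod-trans (mod-reflexive (shift (⟦ k ⟧ (suc n))))
                                    (+-congˡ-mod (+ 1) (⟦ellOf⟧ k₀≡1 n)))
  KZ≡v-ℓ : K * Z ≡ val v - ℓ [mod2^ n ]
  KZ≡v-ℓ = mod-trans (act-zk k₀≡1 (≡⟦⟧-pred K≡k) (act g v)) (act-γ^₂ (ellOf k) v)

cycleLen-of-period : ∀ {α n t} {w : Vec Bool n} → 1 ≤ t →
                     (∀ s → (act (powℕ α s) w ≡ w) ⇔ (t ℕ∣.∣ s)) → CycleLen α w t
cycleLen-of-period {α} {t = t} {w} 1≤t period = 1≤t , Equivalence.from (period t) ℕ∣.∣-refl , minimal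
  where
  minimal : ∀ s → 1 ≤ s → s < t → ¬ act (powℕ α s) w ≡ w
  minimal s 1≤s s<t fixed =
    ℕ.<⇒≱ s<t (ℕ∣.∣⇒≤ {{ℕ.>-nonZero 1≤s}} (Equivalence.to (period s) fixed))

-- The conjugacy and the stable cycles of γ^m z_k

module Conjugacy {k m : ℤ₂} (k₀≡1 : Unit₂ k) (ℓ₀≡1 : ellOf k 0 ≡ true) (m₀≡0 : m 0 ≡ false) where

  -- An odd representative of k modulo 2ⁿ (⟦ k ⟧ 0 = 0 is not odd).
  κ : ℕ → ℤ
  κ n = ⟦ k ⟧ (suc n)

  κ-odd : ∀ n → Odd (κ n)
  κ-odd = ⟦⟧-odd k₀≡1

  κ≡k : ∀ n → κ n ≡ ⟦ k ⟧ n [mod2^ n ]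
  κ≡k n = ≡⟦⟧-pred mod-refl

  ℓ′ : ℕ → ℤ
  ℓ′ n = ⟦ ellOf k ⟧ (suc n)

  -- D = (m / 2) / ℓ, so that (k - 1) D = m.
  D : ℕ → ℤ
  D n = ⟦ half m ⟧ n * inverse n (ℓ′ n)

  ℓ′D≡h : ∀ n → ℓ′ n * D n ≡ ⟦ half m ⟧ n [mod2^ n ]
  ℓ′D≡h n = begin
    ℓ′ n * (⟦ half m ⟧ n * inverse n (ℓ′ n))  ≡⟨ commute (ℓ′ n) (⟦ half m ⟧ n) (inverse n (ℓ′ n)) ⟩
    ⟦ half m ⟧ n * (ℓ′ n * inverse n (ℓ′ n))  ≈⟨ *-congˡ-mod (⟦ half m ⟧ n) (*-inverse (⟦⟧-odd ℓ₀≡1 n) n) ⟩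
    ⟦ half m ⟧ n * + 1                        ≡⟨ ℤ.*-identityʳ (⟦ half m ⟧ n) ⟩
    ⟦ half m ⟧ n                              ∎
    where
    open mod-Reasoning n
    commute : ∀ a b c → a * (b * c) ≡ b * (a * c)
    commute = solve-∀

  D-coherent : Coherent D
  D-coherent {i} {n} i≤n = odd-cancel (⟦⟧-odd ℓ₀≡1 i) (begin
    ℓ′ i * D n    ≈⟨ *-congʳ-mod (D n) (mod-pred (⟦⟧-coherent (ellOf k) (s≤s i≤n))) ⟨
    ℓ′ n * D n    ≈⟨ mod-weaken i≤n (ℓ′D≡h n) ⟩
    ⟦ half m ⟧ n  ≈⟨ ⟦⟧-coherent (half m) i≤n ⟩
    ⟦ half m ⟧ i  ≈⟨ ℓ′D≡h i ⟨
    ℓ′ i * D i    ∎)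
    where open mod-Reasoning i

  [κ-1]D≡m : ∀ n → (κ n - + 1) * D n ≡ ⟦ m ⟧ n [mod2^ n ]
  [κ-1]D≡m n = mod-trans (mod-pred (begin
    (κ n - + 1) * D n               ≈⟨ *-congʳ-mod (D n) (⟦ellOf⟧ k₀≡1 n) ⟩
    + 2 * ⟦ ellOf k ⟧ n * D n       ≡⟨ ℤ.*-assoc (+ 2) (⟦ ellOf k ⟧ n) (D n) ⟩
    + 2 * (⟦ ellOf k ⟧ n * D n)     ≈⟨ double-mod (*-congʳ-mod (D n) (mod-sym (⟦⟧-coherent (ellOf k) (ℕ.n≤1+n n)))) ⟩
    + 2 * (ℓ′ n * D n)              ≈⟨ double-mod (ℓ′D≡h n) ⟩
    + 2 * ⟦ half m ⟧ n              ≡⟨ trans (cong (λ b → bit b + + 2 * ⟦ half m ⟧ n) m₀≡0) (ℤ.+-identityˡ _) ⟨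
    bit (m 0) + + 2 * ⟦ half m ⟧ n  ≡⟨ ⟦⟧-half m n ⟨
    ⟦ m ⟧ (suc n)                   ∎)) (⟦⟧-coherent m (ℕ.n≤1+n n))
    where open mod-Reasoning (suc n)

  α : Aut
  α = (γ ^₂ m) · zk k

  act-α : ∀ {n} (v : Vec Bool n) → κ n * val (act α v) ≡ val v - ⟦ m ⟧ n [mod2^ n ]
  act-α {n} v = mod-trans (mod-reflexive (cong (λ u → κ n * val u) (act-· (γ ^₂ m) (zk k) v)))
                          (mod-trans (act-zk k₀≡1 (κ≡k n) (act (γ ^₂ m) v)) (act-γ^₂ m v))

  Y : ∀ {n} → Vec Bool n → ℤ
  Y {n} v = val v + D n

  κY-step : ∀ {n} (v : Vec Bool n) → κ n * Y (act α v) ≡ Y v [mod2^ n ]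
  κY-step {n} v = begin
    κ n * (val (act α v) + D n)            ≡⟨ ℤ.*-distribˡ-+ (κ n) (val (act α v)) (D n) ⟩
    κ n * val (act α v) + κ n * D n        ≈⟨ +-congʳ-mod (κ n * D n) (act-α v) ⟩
    val v - ⟦ m ⟧ n + κ n * D n            ≈⟨ +-congʳ-mod (κ n * D n) (-‿congˡ-mod (val v) ([κ-1]D≡m n)) ⟨
    val v - (κ n - + 1) * D n + κ n * D n  ≡⟨ cancel (val v) (κ n) (D n) ⟩
    val v + D n                            ∎
    where
    open mod-Reasoning n
    cancel : ∀ a κ d → a - (κ - + 1) * d + κ * d ≡ a + d
    cancel = solve-∀

  κY-orbit : ∀ s {n} (v : Vec Bool n) → κ n ^ℤ s * Y (act (powℕ α s) v) ≡ Y v [mod2^ n ]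
  κY-orbit zero    v = mod-reflexive (trans (ℤ.*-identityˡ _) (cong Y (act-idA v)))
  κY-orbit (suc s) {n} v = begin
    κ n * κ n ^ℤ s * Y (act (powℕ α s · α) v)        ≡⟨ cong (λ u → κ n * κ n ^ℤ s * Y u) (act-· (powℕ α s) α v) ⟩
    κ n * κ n ^ℤ s * Y (act α (act (powℕ α s) v))    ≡⟨ rotate (κ n) (κ n ^ℤ s) _ ⟩
    κ n ^ℤ s * (κ n * Y (act α (act (powℕ α s) v)))  ≈⟨ *-congˡ-mod (κ n ^ℤ s) (κY-step (act (powℕ α s) v)) ⟩
    κ n ^ℤ s * Y (act (powℕ α s) v)                  ≈⟨ κY-orbit s v ⟩
    Y v                                              ∎
    where
    open mod-Reasoning n
    rotate : ∀ a b c → a * b * c ≡ b * (a * c)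
    rotate = solve-∀

  Y-injective : ∀ {n} (v w : Vec Bool n) → Y v ≡ Y w [mod2^ n ] → v ≡ w
  Y-injective {n} v w Yv≡Yw = val-injective v w (+-cancelʳ-mod (D n) Yv≡Yw)

  β : Aut
  β = γ^⟨ (λ n → residue n (- D n)) ⟩

  act-β : ∀ {n} (v : Vec Bool n) → val (act β v) ≡ Y v [mod2^ n ]
  act-β {n} v = begin
    val (act β v)                ≈⟨ act-γ^⟨⟩ coherent v ⟩
    val v - + residue n (- D n)  ≈⟨ -‿congˡ-mod (val v) (residue-≡ n (- D n)) ⟩
    val v - - D n                ≡⟨ cong (_+_ (val v)) (ℤ.neg-involutive (D n)) ⟩
    val v + D n                  ∎
    where
    open mod-Reasoning n
    coherent : Coherent (λ n → + residue n (- D n))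
    coherent {i} {n} i≤n = mod-trans (mod-weaken i≤n (residue-≡ n (- D n)))
      (mod-trans (neg-cong-mod (D-coherent i≤n)) (mod-sym (residue-≡ i (- D i))))

  conjugate : Conjugate α (zk k)
  conjugate = β , ≈A-from-action (α · β) (β · zk k) same-action
    where
    same-action : ∀ {n} (u : Vec Bool n) → act (α · β) u ≡ act (β · zk k) u
    same-action {n} u = begin
      act (α · β) u         ≡⟨ act-· α β u ⟩
      act β (act α u)       ≡⟨ val-injective _ _ (odd-cancel (κ-odd n) (mod-trans via-α (mod-sym via-β))) ⟩
      act (zk k) (act β u)  ≡⟨ act-· β (zk k) u ⟨
      act (β · zk k) u      ∎
      where
      open ≡-Reasoning
      via-α : κ n * val (act β (act α u)) ≡ Y u [mod2^ n ]
      via-α = mod-trans (*-congˡ-mod (κ n) (act-β (act α u))) (κY-step u)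
      via-β : κ n * val (act (zk k) (act β u)) ≡ Y u [mod2^ n ]
      via-β = mod-trans (act-zk k₀≡1 (κ≡k n) (act β u)) (act-β u)

  module StableCycles {j : ℕ} (k+1-val : V2≡ (k +₂ one₂) j) where

    1≤j : 1 ≤ j
    1≤j = unit+1-valuation-positive {k} k₀≡1 k+1-val

    κ-1-val₂ : ∀ n → 1 ≤ n → Val₂ 1 (κ n - + 1)
    κ-1-val₂ (suc n) _ = val₂-cong (val₂ (⟦ ellOf k ⟧ (suc n)) (⟦⟧-odd ℓ₀≡1 n) refl)
                                   (mod-weaken (s≤s (s≤s z≤n)) (⟦ellOf⟧ k₀≡1 (suc n)))

    κ+1-val₂ : ∀ n → j ≤ n → Val₂ j (κ n + + 1)
    κ+1-val₂ n j≤n = val₂-cong (val₂-two^ j) (begin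
      ⟦ k ⟧ (suc n) + + 1               ≡⟨ cong (_+_ (⟦ k ⟧ (suc n))) (⟦one₂⟧ n) ⟨
      ⟦ k ⟧ (suc n) + ⟦ one₂ ⟧ (suc n)  ≈⟨ mod-weaken (s≤s j≤n) (⟦⟧-+₂ k one₂ (suc n)) ⟨
      ⟦ k +₂ one₂ ⟧ (suc n)             ≈⟨ ⟦⟧-coherent (k +₂ one₂) (s≤s j≤n) ⟩
      ⟦ k +₂ one₂ ⟧ (suc j)             ≡⟨ ⟦⟧-V2≡ k+1-val ⟩
      two^ j                            ∎)
      where open mod-Reasoning (suc j)

    fixes⇔ : ∀ {r a} (w : Vec Bool (r ℕ.+ a)) → Val₂ a (Y w) → ∀ s →
             (act (powℕ α s) w ≡ w) ⇔ (κ (r ℕ.+ a) ^ℤ s ≡ + 1 [mod2^ r ])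
    fixes⇔ {r} {a} w Yw-val₂ s = mk⇔ fixed⇒≡1 ≡1⇒fixed
      where
      R : ℕ
      R = r ℕ.+ a
      Kˢ : ℤ
      Kˢ = κ R ^ℤ s
      open mod-Reasoning R
      fixed⇒≡1 : act (powℕ α s) w ≡ w → Kˢ ≡ + 1 [mod2^ r ]
      fixed⇒≡1 fixed = val₂-*-cancel Yw-val₂ (begin
        Kˢ * Y w                   ≡⟨ cong (λ u → Kˢ * Y u) fixed ⟨
        Kˢ * Y (act (powℕ α s) w)  ≈⟨ κY-orbit s w ⟩
        Y w                        ≡⟨ ℤ.*-identityˡ (Y w) ⟨
        + 1 * Y w                  ∎)
      ≡1⇒fixed : Kˢ ≡ + 1 [mod2^ r ] → act (powℕ α s) w ≡ w
      ≡1⇒fixed Kˢ≡1 = Y-injective _ _ (odd-cancel (odd-^ (κ-odd R) s) (begin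
        Kˢ * Y (act (powℕ α s) w)  ≈⟨ κY-orbit s w ⟩
        Y w                        ≡⟨ ℤ.*-identityˡ (Y w) ⟨
        + 1 * Y w                  ≈⟨ val₂-*-cong Yw-val₂ Kˢ≡1 ⟨
        Kˢ * Y w                   ∎))

    cycleLen-of-val₂ : ∀ e a {R} → R ≡ suc e ℕ.+ j ℕ.+ a → (w : Vec Bool R) → Val₂ a (Y w) →
                       CycleLen α w (2 ^ suc e)
    cycleLen-of-val₂ e a refl w Yw-val₂ =
      cycleLen-of-period (ℕ.m^n>0 2 (suc e)) (λ s → order e s ⇔-∘ fixes⇔ w Yw-val₂ s)
      where
      R : ℕ
      R = suc e ℕ.+ j ℕ.+ a
      j≤R : j ≤ R
      j≤R = ℕ.≤-trans (ℕ.m≤n+m j (suc e)) (ℕ.m≤m+n (suc e ℕ.+ j) a)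
      open MultiplicativeOrder {κ R} 1≤j (κ-1-val₂ R (s≤s z≤n)) (κ+1-val₂ R j≤R)

    val₂-orbit : ∀ {a n} (v : Vec Bool n) → a < n → Val₂ a (Y v) →
                 ∀ t → Val₂ a (Y (act (powℕ α t) v))
    val₂-orbit v a<n Yv-val₂ t =
      val₂-cancel-odd (odd-^ (κ-odd _) t) (val₂-cong Yv-val₂ (mod-weaken a<n (κY-orbit t v)))

    val₂-above : ∀ {a n} (v : Vec Bool n) → a < n → Val₂ a (Y v) →
                 ∀ d (w : Vec Bool (n ℕ.+ suc d)) → InOrbit α v (take n w) → Val₂ a (Y w)
    val₂-above {n = n} v a<n Yv-val₂ d w (t , orbit) =
      val₂-cong (val₂-orbit v a<n Yv-val₂ t) (mod-weaken a<n (begin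
        val w + D (n ℕ.+ suc d)  ≈⟨ +-cong-mod (val-take n w) (D-coherent (ℕ.m≤m+n n (suc d))) ⟩
        val (take n w) + D n     ≡⟨ cong Y orbit ⟨
        Y (act (powℕ α t) v)     ∎))
      where open mod-Reasoning n

    stable-of-val₂ : ∀ e a {n} → n ≡ suc e ℕ.+ j ℕ.+ a → (v : Vec Bool n) → Val₂ a (Y v) →
                     StableCycle α v (2 ^ suc e)
    stable-of-val₂ e a {n} n≡ v Yv-val₂ = cycleLen-of-val₂ e a n≡ v Yv-val₂ , above
      where
      a<n : a < n
      a<n = subst (a <_) (sym n≡) (ℕ.m<n+m a (s≤s z≤n))
      above : ∀ d (w : Vec Bool (n ℕ.+ suc d)) → InOrbit α v (take n w) →
              CycleLen α w (2 ^ suc d ℕ.* 2 ^ suc e)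
      above d w orbit = subst (CycleLen α w) 2^-split
        (cycleLen-of-val₂ (e ℕ.+ suc d) a level w (val₂-above v a<n Yv-val₂ d w orbit))
        where
        2^-split : 2 ^ suc (e ℕ.+ suc d) ≡ 2 ^ suc d ℕ.* 2 ^ suc e
        2^-split = trans (ℕ.^-distribˡ-+-* 2 (suc e) (suc d)) (ℕ.*-comm (2 ^ suc e) (2 ^ suc d))
        shuffle : ∀ e j a d → suc e ℕ.+ j ℕ.+ a ℕ.+ d ≡ suc (e ℕ.+ d) ℕ.+ j ℕ.+ a
        shuffle = ℕ-solve-∀
        level : n ℕ.+ suc d ≡ suc (e ℕ.+ suc d) ℕ.+ j ℕ.+ a
        level = trans (cong (ℕ._+ suc d) n≡) (shuffle e j a (suc d))

    -- One candidate for each residue of Y v / 2^(n - j) modulo 2^j.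
    exceptional : ∀ n → List (Vec Bool n)
    exceptional n = tabulate λ (i : Fin (2 ^ j)) → digits n (two^ (n ∸ j) * + toℕ i - D n)

    exceptional-∈ : ∀ {n} → j ≤ n → (v : Vec Bool n) → Y v ≡ + 0 [mod2^ n ∸ j ] → v ∈ exceptional n
    exceptional-∈ {n} j≤n v (mod2^ (divides q Yv-0≡q2ᵉ)) =
      subst (_∈ exceptional n) (sym v≡) (∈-tabulate⁺ i)
      where
      e : ℕ
      e = n ∸ j
      i : Fin (2 ^ j)
      i = fromℕ< (residue-< j q)
      i≡q : + toℕ i ≡ q [mod2^ j ]
      i≡q = subst (λ t → + t ≡ q [mod2^ j ]) (sym (toℕ-fromℕ< (residue-< j q))) (residue-≡ j q)
      split : ∀ a d → a ≡ a + d - + 0 - d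
      split = solve-∀
      2ᵉq≡2ᵉi : two^ e * q ≡ two^ e * + toℕ i [mod2^ n ]
      2ᵉq≡2ᵉi = subst (two^ e * q ≡ two^ e * + toℕ i [mod2^_]) (ℕ.m∸n+n≡m j≤n) (*two^-mod e (mod-sym i≡q))
      v≡ : v ≡ digits n (two^ e * + toℕ i - D n)
      v≡ = val-injective _ _ (begin
        val v                                    ≡⟨ split (val v) (D n) ⟩
        Y v - + 0 - D n                          ≡⟨ cong (_- D n) (trans Yv-0≡q2ᵉ (ℤ.*-comm q (two^ e))) ⟩
        two^ e * q - D n                         ≈⟨ -‿congʳ-mod (D n) 2ᵉq≡2ᵉi ⟩
        two^ e * + toℕ i - D n                   ≈⟨ val-digits n _ ⟨
        val (digits n (two^ e * + toℕ i - D n))  ∎)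
        where open mod-Reasoning n

    stable-unless-exceptional : ∀ {n} → j ≤ n → (v : Vec Bool n) → ¬ v ∈ exceptional n →
                                InStableCycle α v
    stable-unless-exceptional {n} j≤n v v∉ with val₂-or-divisible (n ∸ j) (Y v)
    ... | inj₁ Yv≡0                = contradiction (exceptional-∈ j≤n v Yv≡0) v∉
    ... | inj₂ (a , a<e , Yv-val₂) = 2 ^ suc c , stable-of-val₂ c a level v Yv-val₂
      where
      c : ℕ
      c = n ∸ j ∸ suc a
      shuffle : ∀ c j a → suc c ℕ.+ j ℕ.+ a ≡ suc a ℕ.+ c ℕ.+ j
      shuffle = ℕ-solve-∀
      level : n ≡ suc c ℕ.+ j ℕ.+ a
      level = sym (trans (shuffle c j a) (trans (cong (ℕ._+ j) (ℕ.m+[n∸m]≡n a<e)) (ℕ.m∸n+n≡m j≤n)))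

    few-unstable-vertices : ∀ n → j ≤ n → ∃ λ (L : List (Vec Bool n)) → (length L ≤ 2 ^ j) ×
                              (∀ v → ¬ (v ∈ L) → InStableCycle α v)
    few-unstable-vertices n j≤n =
      exceptional n , ℕ.≤-reflexive (length-tabulate _) , stable-unless-exceptional j≤n

proposition4p13 : (m k : ℤ₂) → Unit₂ k → ¬ (k ≈₂ (-₂ one₂)) →
    V2≡ (ellOf k) 0 → V2≥ m 1 →
    Conjugate ((γ ^₂ m) · zk k) (zk k) ×
    (∀ j → V2≡ (k +₂ one₂) j → ∀ n → j ≤ n →
      ∃ λ (L : List (Vec Bool n)) → (length L ≤ 2 ^ j) ×
        (∀ v → ¬ (v ∈ L) → InStableCycle ((γ ^₂ m) · zk k) v))
proposition4p13 m k k₀≡1 _ (_ , ℓ₀≡1) m-even =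
  conjugate , λ j k+1-val → StableCycles.few-unstable-vertices k+1-val
  where open Conjugacy {k} {m} k₀≡1 ℓ₀≡1 (m-even 0 (s≤s z≤n))
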